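{- There is an absolute constant $C$ such that for every ordered rooted tree $T$, all integers $a,b,c$, and every integer $k\ge 1$, the number of nonempty subforests $F$ of $T$ that simultaneously satisfy $|\mathsf{size}(LU_F)-a|\le k$, $|\mathsf{size}(RU_F)-b|\le k$, and $|\mathsf{size}(F)-c|\le k$ is at most $Ck^2$.
   Context: Ordered rooted trees and forests: children of each node are linearly ordered, a forest is a linearly ordered sequence of trees. Removing a node $v$ from a forest deletes $v$ and puts its children, in order, in the place of $v$. A subforest of $T$ is a forest obtained from $T$ by a finite sequence of removals of the leftmost root or the rightmost root; its nodes form a subset of the nodes of $T$. $\mathsf{size}$ counts nodes. Let $\mathsf{pre}(u)$, $\mathsf{post}(u)$ be the indices of $u$ in the preorder and postorder traversals of $T$. For a nonempty subforest $F$ of $T$, let $\mathsf{LCA}(F)$ be the lowest common ancestor in $T$ of all nodes of $F$; $MU_F$ is the set of nodes on the path from the root of $T$ to $\mathsf{LCA}(F)$, where $\mathsf{LCA}(F)$ is included iff $\mathsf{LCA}(F)\notin F$; $LU_F=\{u\in T\setminus MU_F:\mathsf{pre}(u)<\mathsf{pre}(v)\text{ for all }v\in F\}$; $RU_F=\{u\in T\setminus MU_F:\mathsf{post}(u)>\mathsf{post}(v)\text{ for all }v\in F\}$. -}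

module Defs where

open import Data.Nat using (ℕ; zero; suc; _≡ᵇ_; _<ᵇ_)
open import Data.Bool using (Bool; true; false; not; _∧_; _∨_; if_then_else_)
open import Data.List using (List; []; _∷_; _++_; _∷ʳ_; length; filterᵇ; foldr)
open import Data.Bool.ListAction using (all; any)
open import Data.Product using (_×_; _,_; proj₁; proj₂)

data OTree : Set where
  node : List OTree → OTree

-- Node-labelled ordered trees and forests (labels identify nodes of T).
data Tree (A : Set) : Set where
  lnode : A → List (Tree A) → Tree A

Forest : Set → Set
Forest A = List (Tree A)

-- Label every node of an ordered tree by its (0-based) preorder index.
mutual
  labT : ℕ → OTree → Tree ℕ × ℕ
  labT n (node ts) with labF (suc n) ts
  ... | fs , m = lnode n fs , m

  labF : ℕ → List OTree → Forest ℕ × ℕ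
  labF n [] = [] , n
  labF n (t ∷ ts) with labT n t
  ... | t' , m with labF m ts
  ...   | ts' , m' = t' ∷ ts' , m'

label : OTree → Tree ℕ
label T = proj₁ (labT 0 T)

mutual
  preT : {A : Set} → Tree A → List A
  preT (lnode a ts) = a ∷ preF ts

  preF : {A : Set} → Forest A → List A
  preF [] = []
  preF (t ∷ ts) = preT t ++ preF ts

mutual
  postT : {A : Set} → Tree A → List A
  postT (lnode a ts) = postF ts ∷ʳ a

  postF : {A : Set} → Forest A → List A
  postF [] = []
  postF (t ∷ ts) = postT t ++ postF ts

-- Subforests: obtained from a forest by finitely many removals of the
-- leftmost root or of the rightmost root (children put in its place).
data SubforestOf {A : Set} (T : Forest A) : Forest A → Set where
  here  : SubforestOf T T
  dropL : ∀ {a cs ts} → SubforestOf T (lnode a cs ∷ ts) → SubforestOf T (cs ++ ts)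
  dropR : ∀ {a cs ts} → SubforestOf T (ts ∷ʳ lnode a cs) → SubforestOf T (ts ++ cs)

elem : ℕ → List ℕ → Bool
elem x = any (λ y → x ≡ᵇ y)

indexOf : ℕ → List ℕ → ℕ
indexOf x [] = 0
indexOf x (y ∷ ys) = if x ≡ᵇ y then 0 else suc (indexOf x ys)

mutual
  subT : ℕ → Tree ℕ → List ℕ
  subT u (lnode a ts) = if u ≡ᵇ a then preT (lnode a ts) else subF u ts

  subF : ℕ → Forest ℕ → List ℕ
  subF u [] = []
  subF u (t ∷ ts) = subT u t ++ subF u ts

module _ (T : OTree) (F : Forest ℕ) where
  private
    LT : Tree ℕ
    LT = label T

    N : List ℕ
    N = preT LT

    FN : List ℕ
    FN = preF F

  pre : ℕ → ℕ
  pre u = u               -- labels are preorder indices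

  post : ℕ → ℕ
  post u = indexOf u (postT LT)

  -- u is an ancestor of v in T (or u = v)
  anc : ℕ → ℕ → Bool
  anc u v = elem v (subT u LT)

  depth : ℕ → ℕ
  depth u = length (filterᵇ (λ w → anc w u) N)

  commonAnc : ℕ → Bool
  commonAnc u = all (anc u) FN

  LCA : ℕ
  LCA = foldr (λ u best → if depth best <ᵇ depth u then u else best)
              0 (filterᵇ commonAnc N)

  -- MU_F: path from the root to LCA(F), LCA included iff LCA ∉ F
  inMU : ℕ → Bool
  inMU u = anc u LCA ∧ (not (u ≡ᵇ LCA) ∨ not (elem LCA FN))

  LU : List ℕ
  LU = filterᵇ (λ u → not (inMU u) ∧ all (λ v → pre u <ᵇ pre v) FN) N

  RU : List ℕ
  RU = filterᵇ (λ u → not (inMU u) ∧ all (λ v → post v <ᵇ post u) FN) N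

sizeLU sizeRU sizeF : OTree → Forest ℕ → ℕ
sizeLU T F = length (LU T F)
sizeRU T F = length (RU T F)
sizeF T F = length (preF F)

-- Label the nodes of T by their preorder index.  Every subforest of T is a
-- window: the forest induced on the nodes u with pre(u) ≥ p and post(u) < q,
-- because removing the leftmost (rightmost) root of a window only raises p
-- (lowers q).  For a nonempty window F let L be the nodes preceding all of F
-- in preorder and R those following all of F in postorder.  Then L ∩ R = MU_F,
-- L = LU_F ∪ MU_F, R = RU_F ∪ MU_F, and F consists of the nodes in neither L
-- nor R; hence |L| = n − |RU_F| − |F| and |R| = n − |LU_F| − |F|, so each of
-- |L|, |R| ranges over an interval of length 4k.  As L is an initial segment
-- of the preorder and R a final segment of the postorder, F is determined by
-- (|L|, |R|), leaving at most (8k+1)² ≤ 81k² subforests.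

module Submission where

open import Defs
open import Data.Nat using (ℕ; _≤_; _*_)
open import Data.Integer using (ℤ; +_; _-_; ∣_∣)
open import Data.List using (List; []; _∷_; length)
open import Data.List.Relation.Unary.All using (All)
open import Data.List.Relation.Unary.Unique.Propositional using (Unique)
open import Data.Product using (Σ; _×_)
open import Relation.Binary.PropositionalEquality using (_≢_)

open import Data.Bool using (Bool; true; false; T; not; _∧_; _∨_; if_then_else_)
open import Data.Bool.ListAction using (all)
open import Data.Bool.Properties using (not-injective; T-≡; T-∧; T-∨; ∨-comm)
open import Data.Empty using (⊥-elim)
open import Data.List using (_++_; _∷ʳ_; [_]; filterᵇ; foldr; lookup)
open import Data.List.Properties using (++-assoc; ++-identityʳ; length-++; filter-++; filter-none; filter-accept; filter-reject)
open import Data.List.Membership.Propositional using (_∈_; _∉_)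
open import Data.List.Membership.Propositional.Properties using (∈-++⁺ˡ; ∈-++⁺ʳ; ∈-++⁻; ∈-filter⁺; ∈-filter⁻; ∈-lookup)
open import Data.Fin using (Fin; zero; suc; fromℕ<; combine)
open import Data.Fin.Properties using (injective⇒≤; combine-injective; fromℕ<-injective)
open import Data.List.Relation.Binary.Subset.Propositional using (_⊆_)
import Data.List.Relation.Unary.AllPairs as AllPairs
import Data.List.Relation.Unary.AllPairs.Properties as AllPairsₚ
open import Data.List.Relation.Unary.All using ([]; _∷_)
import Data.List.Relation.Unary.All as All
import Data.List.Relation.Unary.All.Properties as Allₚ
open import Data.List.Relation.Unary.AllPairs using (AllPairs; []; _∷_)
open import Data.List.Relation.Unary.Any using (here; there)
import Data.List.Relation.Unary.Any as Any
open import Data.List.Relation.Unary.Any.Properties using (any⁺; any⁻)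
open import Data.Nat using (zero; suc; _+_; _∸_; _<_; _≡ᵇ_; _<ᵇ_; _≤ᵇ_; _≤?_; _<?_; z≤n; s≤s)
open import Data.Nat.Properties
open import Data.Nat.Solver using (module +-*-Solver)
open import Data.Integer using (_⊖_)
import Data.Integer.Properties as ℤ
open import Data.Integer.Solver using () renaming (module +-*-Solver to ℤ-Solver)
open import Data.Product using (_,_; proj₁; proj₂)
import Data.Product
open import Data.Sum using (_⊎_; inj₁; inj₂)
import Data.Sum
open import Data.Unit using (tt)
open import Function using (_∘_; Equivalence)
open import Relation.Binary.PropositionalEquality hiding ([_])
open import Relation.Nullary using (¬_; yes; no; contradiction)
open import Relation.Nullary.Decidable using (T?)

T-ext : ∀ {a b} → (T a → T b) → (T b → T a) → a ≡ b
T-ext {false} {false} _ _ = refl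
T-ext {false} {true}  _ g = ⊥-elim (g tt)
T-ext {true}  {false} f _ = ⊥-elim (f tt)
T-ext {true}  {true}  _ _ = refl

T-not⁻ : ∀ {b} → T (not b) → ¬ T b
T-not⁻ {false} _ ()

T-not⁺ : ∀ {b} → ¬ T b → T (not b)
T-not⁺ {false} _ = tt
T-not⁺ {true}  h = h tt

≡ᵇ-refl : ∀ x → (x ≡ᵇ x) ≡ true
≡ᵇ-refl x = Equivalence.to T-≡ (≡⇒≡ᵇ x x refl)

≡ᵇ-true⇒≡ : ∀ x y → (x ≡ᵇ y) ≡ true → x ≡ y
≡ᵇ-true⇒≡ x y e = ≡ᵇ⇒≡ x y (subst T (sym e) tt)

≡ᵇ-false⇒≢ : ∀ x y → (x ≡ᵇ y) ≡ false → x ≢ y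
≡ᵇ-false⇒≢ x _ e refl = subst T e (≡⇒≡ᵇ x x refl)

elem⇒∈ : ∀ {x} xs → T (elem x xs) → x ∈ xs
elem⇒∈ {x} xs h = Any.map (≡ᵇ⇒≡ x _) (any⁻ (x ≡ᵇ_) xs h)

∈⇒elem : ∀ {x xs} → x ∈ xs → T (elem x xs)
∈⇒elem {x} m = any⁺ (x ≡ᵇ_) (Any.map (≡⇒≡ᵇ x _) m)

all-lookup : ∀ {A : Set} (p : A → Bool) {xs x} → T (all p xs) → x ∈ xs → T (p x)
all-lookup p h = All.lookup (Allₚ.all⁺ p _ h)

all-tabulate : ∀ {A : Set} (p : A → Bool) {xs} → (∀ {x} → x ∈ xs → T (p x)) → T (all p xs)
all-tabulate p f = Allₚ.all⁻ p (All.tabulate f)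

module _ {A : Set} where

  count : (A → Bool) → List A → ℕ
  count p xs = length (filterᵇ p xs)

  count-++ : ∀ p xs ys → count p (xs ++ ys) ≡ count p xs + count p ys
  count-++ p xs ys = trans (cong length (filter-++ (T? ∘ p) xs ys)) (length-++ (filterᵇ p xs))

  count-none : ∀ p {xs} → (∀ {x} → x ∈ xs → ¬ T (p x)) → count p xs ≡ 0
  count-none p f = cong length (filter-none (T? ∘ p) (All.tabulate f))

  count-cong : ∀ p q xs → (∀ {x} → x ∈ xs → p x ≡ q x) → count p xs ≡ count q xs
  count-cong p q [] f = refl
  count-cong p q (y ∷ ys) f with p y | q y | f (here refl)
  ... | true  | true  | _ = cong suc (count-cong p q ys (f ∘ there))
  ... | false | false | _ = count-cong p q ys (f ∘ there)

  count-mono : ∀ p q xs → (∀ {x} → x ∈ xs → T (p x) → T (q x)) → count p xs ≤ count q xs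
  count-mono p q [] f = z≤n
  count-mono p q (y ∷ ys) f with p y in ep | q y in eq
  ... | true  | true  = s≤s (count-mono p q ys (f ∘ there))
  ... | false | true  = m≤n⇒m≤1+n (count-mono p q ys (f ∘ there))
  ... | false | false = count-mono p q ys (f ∘ there)
  ... | true  | false = ⊥-elim (subst T eq (f (here refl) (subst T (sym ep) tt)))

  count-mono-< : ∀ p q xs → (∀ {x} → x ∈ xs → T (p x) → T (q x)) →
                 ∀ {z} → z ∈ xs → T (q z) → ¬ T (p z) → count p xs < count q xs
  count-mono-< p q (y ∷ ys) f (here refl) qz ¬pz with p y | q y
  ... | true  | _     = ⊥-elim (¬pz tt)
  ... | false | false = ⊥-elim qz
  ... | false | true  = s≤s (count-mono p q ys (f ∘ there))
  count-mono-< p q (y ∷ ys) f (there z∈) qz ¬pz with p y in ep | q y in eq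
  ... | true  | true  = s≤s (count-mono-< p q ys (f ∘ there) z∈ qz ¬pz)
  ... | false | true  = m≤n⇒m≤1+n (count-mono-< p q ys (f ∘ there) z∈ qz ¬pz)
  ... | false | false = count-mono-< p q ys (f ∘ there) z∈ qz ¬pz
  ... | true  | false = ⊥-elim (subst T eq (f (here refl) (subst T (sym ep) tt)))

  count-complement : ∀ p xs → count p xs + count (not ∘ p) xs ≡ length xs
  count-complement p [] = refl
  count-complement p (y ∷ ys) with p y
  ... | true  = cong suc (count-complement p ys)
  ... | false = trans (+-suc _ _) (cong suc (count-complement p ys))

  count-partition : ∀ (p q : A → Bool) xs →
    count p xs + count (λ x → not (p x) ∧ q x) xs + count (λ x → not (p x ∨ q x)) xs ≡ length xs
  count-partition p q [] = refl
  count-partition p q (y ∷ ys) with p y | q y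
  ... | true  | _     = cong suc (count-partition p q ys)
  ... | false | true  = trans (cong (_+ count r ys) (+-suc (count p ys) _)) (cong suc (count-partition p q ys))
    where
    r : A → Bool
    r x = not (p x ∨ q x)
  ... | false | false = trans (+-suc _ _) (cong suc (count-partition p q ys))

  DownClosed UpClosed : (A → A → Set) → (A → Bool) → Set
  DownClosed R p = ∀ {x y} → R x y → T (p y) → T (p x)
  UpClosed   R p = ∀ {x y} → R x y → T (p x) → T (p y)

  downClosed-count-unique : ∀ {R} p q {xs} → AllPairs R xs → DownClosed R p → DownClosed R q →
                            count p xs ≡ count q xs → ∀ {x} → x ∈ xs → p x ≡ q x
  downClosed-count-unique p q {y ∷ ys} (r ∷ rs) dp dq eq x∈ with p y in ep | q y in eq′ | x∈
  ... | true  | true  | here refl = trans ep (sym eq′)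
  ... | true  | true  | there x∈′ = downClosed-count-unique p q rs dp dq (suc-injective eq) x∈′
  ... | false | false | here refl = trans ep (sym eq′)
  ... | false | false | there x∈′ = downClosed-count-unique p q rs dp dq eq x∈′
  ... | true  | false | _ = ⊥-elim (0≢1+n (sym (trans eq (count-none q λ z∈ qz → subst T eq′ (dq (All.lookup r z∈) qz)))))
  ... | false | true  | _ = ⊥-elim (0≢1+n (trans (sym (count-none p λ z∈ pz → subst T ep (dp (All.lookup r z∈) pz))) eq))

  upClosed-count-unique : ∀ {R} p q {xs} → AllPairs R xs → UpClosed R p → UpClosed R q →
                          count p xs ≡ count q xs → ∀ {x} → x ∈ xs → p x ≡ q x
  upClosed-count-unique p q {xs} rs up uq eq x∈ =
    not-injective (downClosed-count-unique (not ∘ p) (not ∘ q) rs (flip p up) (flip q uq) eq-not x∈)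
    where
    flip : ∀ {R} r → UpClosed R r → DownClosed R (not ∘ r)
    flip r ur Rxy ¬ry = T-not⁺ (T-not⁻ ¬ry ∘ ur Rxy)
    eq-not : count (not ∘ p) xs ≡ count (not ∘ q) xs
    eq-not = +-cancelˡ-≡ (count p xs) _ _
      (trans (count-complement p xs) (trans (sym (count-complement q xs)) (cong (_+ _) (sym eq))))

module _ {A : Set} {R : A → A → Set} where

  AllPairs-map∈ : ∀ {S : A → A → Set} {xs} → (∀ {x y} → x ∈ xs → y ∈ xs → R x y → S x y) →
                  AllPairs R xs → AllPairs S xs
  AllPairs-map∈ f [] = []
  AllPairs-map∈ f (r ∷ rs) =
    All.tabulate (λ y∈ → f (here refl) (there y∈) (All.lookup r y∈)) ∷ AllPairs-map∈ (λ x∈ y∈ → f (there x∈) (there y∈)) rs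

  AllPairs-++⁻ˡ : ∀ xs {ys} → AllPairs R (xs ++ ys) → AllPairs R xs
  AllPairs-++⁻ˡ []       _        = []
  AllPairs-++⁻ˡ (x ∷ xs) (r ∷ rs) = All.tabulate (All.lookup r ∘ ∈-++⁺ˡ) ∷ AllPairs-++⁻ˡ xs rs

  AllPairs-++⁻ʳ : ∀ xs {ys} → AllPairs R (xs ++ ys) → AllPairs R ys
  AllPairs-++⁻ʳ []       rs       = rs
  AllPairs-++⁻ʳ (x ∷ xs) (_ ∷ rs) = AllPairs-++⁻ʳ xs rs

  AllPairs-++⁻-across : ∀ xs {ys} → AllPairs R (xs ++ ys) → ∀ {x y} → x ∈ xs → y ∈ ys → R x y
  AllPairs-++⁻-across (_ ∷ xs) (r ∷ _)  (here refl) y∈ = All.lookup r (∈-++⁺ʳ xs y∈)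
  AllPairs-++⁻-across (_ ∷ xs) (_ ∷ rs) (there x∈)  y∈ = AllPairs-++⁻-across xs rs x∈ y∈

indexOf-here : ∀ x xs → indexOf x (x ∷ xs) ≡ 0
indexOf-here x xs rewrite ≡ᵇ-refl x = refl

indexOf-there : ∀ {x y} xs → x ≢ y → indexOf x (y ∷ xs) ≡ suc (indexOf x xs)
indexOf-there {x} {y} xs x≢y with x ≡ᵇ y in e
... | true  = contradiction (≡ᵇ⇒≡ x y (subst T (sym e) tt)) x≢y
... | false = refl

indexOf-++ˡ : ∀ {x} xs ys → x ∈ xs → indexOf x (xs ++ ys) ≡ indexOf x xs
indexOf-++ˡ {x} (y ∷ xs) ys x∈ with x ≟ y
... | yes refl = trans (indexOf-here x (xs ++ ys)) (sym (indexOf-here x xs))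
... | no x≢y   = begin
  indexOf x (y ∷ xs ++ ys)   ≡⟨ indexOf-there (xs ++ ys) x≢y ⟩
  suc (indexOf x (xs ++ ys)) ≡⟨ cong suc (indexOf-++ˡ xs ys (Any.tail x≢y x∈)) ⟩
  suc (indexOf x xs)         ≡⟨ indexOf-there xs x≢y ⟨
  indexOf x (y ∷ xs)         ∎
  where open ≡-Reasoning

indexOf-++ʳ : ∀ {x} xs ys → x ∉ xs → indexOf x (xs ++ ys) ≡ length xs + indexOf x ys
indexOf-++ʳ []       ys x∉ = refl
indexOf-++ʳ (y ∷ xs) ys x∉ =
  trans (indexOf-there (xs ++ ys) (x∉ ∘ here)) (cong suc (indexOf-++ʳ xs ys (x∉ ∘ there)))

indexOf<length : ∀ {x} xs → x ∈ xs → indexOf x xs < length xs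
indexOf<length {x} (y ∷ xs) x∈ with x ≟ y
... | yes refl = subst (_< suc (length xs)) (sym (indexOf-here x xs)) (s≤s z≤n)
... | no x≢y   = subst (_< suc (length xs)) (sym (indexOf-there xs x≢y)) (s≤s (indexOf<length xs (Any.tail x≢y x∈)))

indexOf-injective : ∀ {x y} xs → x ∈ xs → y ∈ xs → indexOf x xs ≡ indexOf y xs → x ≡ y
indexOf-injective {x} {y} (z ∷ xs) x∈ y∈ eq with x ≟ z | y ≟ z
... | yes refl | yes refl = refl
... | yes refl | no y≢z   = contradiction (trans (sym (indexOf-here x xs)) (trans eq (indexOf-there xs y≢z))) 0≢1+n
... | no x≢z   | yes refl = contradiction (trans (sym (indexOf-here y xs)) (trans (sym eq) (indexOf-there xs x≢z))) 0≢1+n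
... | no x≢z   | no y≢z   = indexOf-injective xs (Any.tail x≢z x∈) (Any.tail y≢z y∈)
  (suc-injective (trans (sym (indexOf-there xs x≢z)) (trans eq (indexOf-there xs y≢z))))

indexOf-increasing : ∀ xs → Unique xs → AllPairs (λ x y → indexOf x xs < indexOf y xs) xs
indexOf-increasing []       []       = []
indexOf-increasing (z ∷ xs) (u ∷ us) =
  All.tabulate first-is-least ∷ AllPairs-map∈ shift (indexOf-increasing xs us)
  where
  ≢z : ∀ {x} → x ∈ xs → x ≢ z
  ≢z x∈ = All.lookup u x∈ ∘ sym
  first-is-least : ∀ {y} → y ∈ xs → indexOf z (z ∷ xs) < indexOf y (z ∷ xs)
  first-is-least y∈ rewrite indexOf-here z xs | indexOf-there xs (≢z y∈) = s≤s z≤n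
  shift : ∀ {x y} → x ∈ xs → y ∈ xs → indexOf x xs < indexOf y xs → indexOf x (z ∷ xs) < indexOf y (z ∷ xs)
  shift x∈ y∈ lt rewrite indexOf-there xs (≢z x∈) | indexOf-there xs (≢z y∈) = s≤s lt

module _ {A : Set} where

  preF-++ : ∀ (xs ys : Forest A) → preF (xs ++ ys) ≡ preF xs ++ preF ys
  preF-++ []       ys = refl
  preF-++ (t ∷ xs) ys = trans (cong (preT t ++_) (preF-++ xs ys)) (sym (++-assoc (preT t) (preF xs) (preF ys)))

  postF-++ : ∀ (xs ys : Forest A) → postF (xs ++ ys) ≡ postF xs ++ postF ys
  postF-++ []       ys = refl
  postF-++ (t ∷ xs) ys = trans (cong (postT t ++_) (postF-++ xs ys)) (sym (++-assoc (postT t) (postF xs) (postF ys)))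

  nonempty-has-node : (F : Forest A) → F ≢ [] → Σ A (_∈ preF F)
  nonempty-has-node []              F≢[] = contradiction refl F≢[]
  nonempty-has-node (lnode a _ ∷ _) _    = a , here refl

  mutual
    postT⊆preT : (t : Tree A) → postT t ⊆ preT t
    postT⊆preT (lnode a ts) x∈ with ∈-++⁻ (postF ts) x∈
    ... | inj₁ x∈ts       = there (postF⊆preF ts x∈ts)
    ... | inj₂ (here refl) = here refl

    postF⊆preF : (ts : Forest A) → postF ts ⊆ preF ts
    postF⊆preF (t ∷ ts) x∈ with ∈-++⁻ (postT t) x∈
    ... | inj₁ x∈t  = ∈-++⁺ˡ (postT⊆preT t x∈t)
    ... | inj₂ x∈ts = ∈-++⁺ʳ (preT t) (postF⊆preF ts x∈ts)

  mutual
    preT⊆postT : (t : Tree A) → preT t ⊆ postT t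
    preT⊆postT (lnode a ts) (here refl) = ∈-++⁺ʳ (postF ts) (here refl)
    preT⊆postT (lnode a ts) (there x∈)  = ∈-++⁺ˡ (preF⊆postF ts x∈)

    preF⊆postF : (ts : Forest A) → preF ts ⊆ postF ts
    preF⊆postF (t ∷ ts) x∈ with ∈-++⁻ (preT t) x∈
    ... | inj₁ x∈t  = ∈-++⁺ˡ (preT⊆postT t x∈t)
    ... | inj₂ x∈ts = ∈-++⁺ʳ (postT t) (preF⊆postF ts x∈ts)

  mutual
    count-postT : ∀ p (t : Tree A) → count p (postT t) ≡ count p (preT t)
    count-postT p (lnode a ts) = begin
      count p (postF ts ++ a ∷ [])      ≡⟨ count-++ p (postF ts) (a ∷ []) ⟩
      count p (postF ts) + count p [ a ] ≡⟨ +-comm (count p (postF ts)) _ ⟩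
      count p [ a ] + count p (postF ts) ≡⟨ cong (_+_ (count p [ a ])) (count-postF p ts) ⟩
      count p [ a ] + count p (preF ts)  ≡⟨ count-++ p [ a ] (preF ts) ⟨
      count p (a ∷ preF ts)             ∎
      where open ≡-Reasoning

    count-postF : ∀ p (ts : Forest A) → count p (postF ts) ≡ count p (preF ts)
    count-postF p []       = refl
    count-postF p (t ∷ ts) = begin
      count p (postT t ++ postF ts)          ≡⟨ count-++ p (postT t) (postF ts) ⟩
      count p (postT t) + count p (postF ts) ≡⟨ cong₂ _+_ (count-postT p t) (count-postF p ts) ⟩
      count p (preT t) + count p (preF ts)   ≡⟨ count-++ p (preT t) (preF ts) ⟨
      count p (preT t ++ preF ts)            ∎
      where open ≡-Reasoning

  mutual
    unique-postT : (t : Tree A) → Unique (preT t) → Unique (postT t)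
    unique-postT (lnode a ts) (a∉ ∷ u) =
      AllPairsₚ.++⁺ (unique-postF ts u) ([] ∷ [])
        (All.tabulate λ x∈ → (λ x≡a → All.lookup a∉ (postF⊆preF ts x∈) (sym x≡a)) ∷ [])

    unique-postF : (ts : Forest A) → Unique (preF ts) → Unique (postF ts)
    unique-postF []       _ = []
    unique-postF (t ∷ ts) u =
      AllPairsₚ.++⁺ (unique-postT t (AllPairs-++⁻ˡ (preT t) u)) (unique-postF ts (AllPairs-++⁻ʳ (preT t) u))
        (All.tabulate λ x∈ → All.tabulate λ y∈ →
          AllPairs-++⁻-across (preT t) u (postT⊆preT t x∈) (postF⊆preF ts y∈))

-- Subtrees and ancestry

Ascending : List ℕ → Set
Ascending = AllPairs _<_

mutual
  subT⊆preT : ∀ {u v} (t : Tree ℕ) → v ∈ subT u t → u ∈ preT t × v ∈ preT t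
  subT⊆preT {u} (lnode a ts) v∈ with u ≡ᵇ a in e
  ... | true  = subst (_∈ preT (lnode a ts)) (sym (≡ᵇ-true⇒≡ u a e)) (here refl) , v∈
  ... | false = let u∈ , v∈′ = subF⊆preF ts v∈ in there u∈ , there v∈′

  subF⊆preF : ∀ {u v} (ts : Forest ℕ) → v ∈ subF u ts → u ∈ preF ts × v ∈ preF ts
  subF⊆preF {u} (t ∷ ts) v∈ with ∈-++⁻ (subT u t) v∈
  ... | inj₁ v∈t  = let u∈ , v∈′ = subT⊆preT t v∈t  in ∈-++⁺ˡ u∈ , ∈-++⁺ˡ v∈′
  ... | inj₂ v∈ts = let u∈ , v∈′ = subF⊆preF ts v∈ts in ∈-++⁺ʳ (preT t) u∈ , ∈-++⁺ʳ (preT t) v∈′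

private
  later-trees-not-in-postT : ∀ (t : Tree ℕ) ts → Ascending (preT t ++ preF ts) → ∀ {x} → x ∈ preF ts → x ∉ postT t
  later-trees-not-in-postT t ts asc x∈ x∈t = <-irrefl refl (AllPairs-++⁻-across (preT t) asc (postT⊆preT t x∈t) x∈)

mutual
  ∈-subT⇒ordered : ∀ {u v} (t : Tree ℕ) → Ascending (preT t) → v ∈ subT u t →
                   u ≤ v × indexOf v (postT t) ≤ indexOf u (postT t)
  ∈-subT⇒ordered {u} {v} (lnode a ts) asc v∈ with u ≡ᵇ a in e
  ... | false
      with u≤v , post≤ ← ∈-subF⇒ordered ts (AllPairs.tail asc) v∈
         | u∈ , v∈′   ← subF⊆preF ts v∈
      rewrite indexOf-++ˡ (postF ts) [ a ] (preF⊆postF ts u∈)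
            | indexOf-++ˡ (postF ts) [ a ] (preF⊆postF ts v∈′) = u≤v , post≤
  ... | true with refl ← ≡ᵇ-true⇒≡ u a e with v∈ | asc
  ...   | here refl  | _      = ≤-refl , ≤-refl
  ...   | there v∈ts | a< ∷ _ = <⇒≤ (All.lookup a< v∈ts) , (begin
      indexOf v (postF ts ++ [ u ])       ≡⟨ indexOf-++ˡ (postF ts) _ (preF⊆postF ts v∈ts) ⟩
      indexOf v (postF ts)                ≤⟨ <⇒≤ (indexOf<length (postF ts) (preF⊆postF ts v∈ts)) ⟩
      length (postF ts)                   ≡⟨ +-identityʳ _ ⟨
      length (postF ts) + 0               ≡⟨ cong (_+_ (length (postF ts))) (indexOf-here u []) ⟨
      length (postF ts) + indexOf u [ u ] ≡⟨ indexOf-++ʳ (postF ts) _ u∉ ⟨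
      indexOf u (postF ts ++ [ u ])       ∎)
    where
    open ≤-Reasoning
    u∉ : u ∉ postF ts
    u∉ u∈ = <-irrefl refl (All.lookup a< (postF⊆preF ts u∈))

  ∈-subF⇒ordered : ∀ {u v} (ts : Forest ℕ) → Ascending (preF ts) → v ∈ subF u ts →
                   u ≤ v × indexOf v (postF ts) ≤ indexOf u (postF ts)
  ∈-subF⇒ordered {u} (t ∷ ts) asc v∈ with ∈-++⁻ (subT u t) v∈
  ... | inj₁ v∈t
      with u≤v , post≤ ← ∈-subT⇒ordered t (AllPairs-++⁻ˡ (preT t) asc) v∈t
         | u∈ , v∈′   ← subT⊆preT t v∈t
      rewrite indexOf-++ˡ (postT t) (postF ts) (preT⊆postT t u∈)
            | indexOf-++ˡ (postT t) (postF ts) (preT⊆postT t v∈′) = u≤v , post≤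
  ... | inj₂ v∈ts
      with u≤v , post≤ ← ∈-subF⇒ordered ts (AllPairs-++⁻ʳ (preT t) asc) v∈ts
         | u∈ , v∈′   ← subF⊆preF ts v∈ts
      rewrite indexOf-++ʳ (postT t) (postF ts) (later-trees-not-in-postT t ts asc u∈)
            | indexOf-++ʳ (postT t) (postF ts) (later-trees-not-in-postT t ts asc v∈′) =
        u≤v , +-monoʳ-≤ (length (postT t)) post≤

mutual
  ordered⇒∈-subT : ∀ {u v} (t : Tree ℕ) → Ascending (preT t) → u ∈ preT t → v ∈ preT t → u ≤ v →
                   indexOf v (postT t) ≤ indexOf u (postT t) → v ∈ subT u t
  ordered⇒∈-subT {u} (lnode a ts) asc u∈ v∈ u≤v post≤ with u ≡ᵇ a in e | u∈ | v∈ | asc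
  ... | true  | _         | _         | _      = v∈
  ... | false | here refl  | _         | _      = contradiction refl (≡ᵇ-false⇒≢ u u e)
  ... | false | there u∈ts | here refl  | a< ∷ _ = contradiction (<-≤-trans (All.lookup a< u∈ts) u≤v) (<-irrefl refl)
  ... | false | there u∈ts | there v∈ts | _ ∷ asc′ =
    ordered⇒∈-subF ts asc′ u∈ts v∈ts u≤v
      (subst₂ _≤_ (indexOf-++ˡ (postF ts) [ a ] (preF⊆postF ts v∈ts))
                  (indexOf-++ˡ (postF ts) [ a ] (preF⊆postF ts u∈ts)) post≤)

  ordered⇒∈-subF : ∀ {u v} (ts : Forest ℕ) → Ascending (preF ts) → u ∈ preF ts → v ∈ preF ts → u ≤ v →
                   indexOf v (postF ts) ≤ indexOf u (postF ts) → v ∈ subF u ts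
  ordered⇒∈-subF {u} {v} (t ∷ ts) asc u∈ v∈ u≤v post≤ with ∈-++⁻ (preT t) u∈ | ∈-++⁻ (preT t) v∈
  ... | inj₁ u∈t | inj₁ v∈t =
    ∈-++⁺ˡ (ordered⇒∈-subT t (AllPairs-++⁻ˡ (preT t) asc) u∈t v∈t u≤v
      (subst₂ _≤_ (indexOf-++ˡ (postT t) (postF ts) (preT⊆postT t v∈t))
                  (indexOf-++ˡ (postT t) (postF ts) (preT⊆postT t u∈t)) post≤))
  ... | inj₂ u∈ts | inj₂ v∈ts =
    ∈-++⁺ʳ (subT u t) (ordered⇒∈-subF ts (AllPairs-++⁻ʳ (preT t) asc) u∈ts v∈ts u≤v
      (+-cancelˡ-≤ (length (postT t)) _ _
        (subst₂ _≤_ (indexOf-++ʳ (postT t) (postF ts) (later-trees-not-in-postT t ts asc v∈ts))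
                    (indexOf-++ʳ (postT t) (postF ts) (later-trees-not-in-postT t ts asc u∈ts)) post≤)))
  ... | inj₂ u∈ts | inj₁ v∈t =
    contradiction (<-≤-trans (AllPairs-++⁻-across (preT t) asc v∈t u∈ts) u≤v) (<-irrefl refl)
  ... | inj₁ u∈t | inj₂ v∈ts = contradiction (≤-<-trans post≤ post-u<post-v) (<-irrefl refl)
    where
    open ≤-Reasoning
    post-u<post-v : indexOf u (postT t ++ postF ts) < indexOf v (postT t ++ postF ts)
    post-u<post-v = begin-strict
      indexOf u (postT t ++ postF ts)            ≡⟨ indexOf-++ˡ (postT t) (postF ts) (preT⊆postT t u∈t) ⟩
      indexOf u (postT t)                        <⟨ indexOf<length (postT t) (preT⊆postT t u∈t) ⟩
      length (postT t)                           ≤⟨ m≤m+n _ _ ⟩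
      length (postT t) + indexOf v (postF ts)    ≡⟨ indexOf-++ʳ (postT t) (postF ts) (later-trees-not-in-postT t ts asc v∈ts) ⟨
      indexOf v (postT t ++ postF ts)            ∎

mutual
  subT-nested : ∀ {u v w} (t : Tree ℕ) → Ascending (preT t) → v ∈ subT w t → v ∈ subT u t →
                u ∈ subT w t ⊎ w ∈ subT u t
  subT-nested {u} {v} {w} (lnode a ts) asc v∈w v∈u with w ≡ᵇ a
  ... | true  = inj₁ (proj₁ (subT⊆preT (lnode a ts) v∈u))
  ... | false with u ≡ᵇ a
  ...   | true  = inj₂ (there (proj₁ (subF⊆preF ts v∈w)))
  ...   | false = subF-nested ts (AllPairs.tail asc) v∈w v∈u

  subF-nested : ∀ {u v w} (ts : Forest ℕ) → Ascending (preF ts) → v ∈ subF w ts → v ∈ subF u ts →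
                u ∈ subF w ts ⊎ w ∈ subF u ts
  subF-nested {u} {v} {w} (t ∷ ts) asc v∈w v∈u with ∈-++⁻ (subT w t) v∈w | ∈-++⁻ (subT u t) v∈u
  ... | inj₁ v∈wt | inj₁ v∈ut =
    Data.Sum.map ∈-++⁺ˡ ∈-++⁺ˡ (subT-nested t (AllPairs-++⁻ˡ (preT t) asc) v∈wt v∈ut)
  ... | inj₂ v∈wts | inj₂ v∈uts =
    Data.Sum.map (∈-++⁺ʳ (subT w t)) (∈-++⁺ʳ (subT u t)) (subF-nested ts (AllPairs-++⁻ʳ (preT t) asc) v∈wts v∈uts)
  ... | inj₁ v∈wt | inj₂ v∈uts = ⊥-elim (<-irrefl refl
    (AllPairs-++⁻-across (preT t) asc (proj₂ (subT⊆preT t v∈wt)) (proj₂ (subF⊆preF ts v∈uts))))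
  ... | inj₂ v∈wts | inj₁ v∈ut = ⊥-elim (<-irrefl refl
    (AllPairs-++⁻-across (preT t) asc (proj₂ (subT⊆preT t v∈ut)) (proj₂ (subF⊆preF ts v∈wts))))

module _ {A : Set} where

  mutual
    pruneT : (A → Bool) → Tree A → Forest A
    pruneT S (lnode a cs) = if S a then lnode a (pruneF S cs) ∷ [] else pruneF S cs

    pruneF : (A → Bool) → Forest A → Forest A
    pruneF S []       = []
    pruneF S (t ∷ ts) = pruneT S t ++ pruneF S ts

  pruneF-++ : ∀ S (xs ys : Forest A) → pruneF S (xs ++ ys) ≡ pruneF S xs ++ pruneF S ys
  pruneF-++ S []       ys = refl
  pruneF-++ S (t ∷ xs) ys =
    trans (cong (pruneT S t ++_) (pruneF-++ S xs ys)) (sym (++-assoc (pruneT S t) (pruneF S xs) (pruneF S ys)))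

  mutual
    preF-pruneT : ∀ S (t : Tree A) → preF (pruneT S t) ≡ filterᵇ S (preT t)
    preF-pruneT S (lnode a cs) with S a
    ... | true  = cong (a ∷_) (trans (++-identityʳ _) (preF-pruneF S cs))
    ... | false = preF-pruneF S cs

    preF-pruneF : ∀ S (ts : Forest A) → preF (pruneF S ts) ≡ filterᵇ S (preF ts)
    preF-pruneF S []       = refl
    preF-pruneF S (t ∷ ts) = begin
      preF (pruneT S t ++ pruneF S ts)               ≡⟨ preF-++ (pruneT S t) (pruneF S ts) ⟩
      preF (pruneT S t) ++ preF (pruneF S ts)        ≡⟨ cong₂ _++_ (preF-pruneT S t) (preF-pruneF S ts) ⟩
      filterᵇ S (preT t) ++ filterᵇ S (preF ts)      ≡⟨ filter-++ (T? ∘ S) (preT t) (preF ts) ⟨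
      filterᵇ S (preT t ++ preF ts)                  ∎
      where open ≡-Reasoning

  mutual
    postF-pruneT : ∀ S (t : Tree A) → postF (pruneT S t) ≡ filterᵇ S (postT t)
    postF-pruneT S (lnode a cs) with S a in e
    ... | true  = begin
      postF (pruneF S cs) ∷ʳ a ++ []        ≡⟨ ++-identityʳ _ ⟩
      postF (pruneF S cs) ∷ʳ a              ≡⟨ cong (_∷ʳ a) (postF-pruneF S cs) ⟩
      filterᵇ S (postF cs) ∷ʳ a             ≡⟨ cong (filterᵇ S (postF cs) ++_) (filter-accept (T? ∘ S) (subst T (sym e) tt)) ⟨
      filterᵇ S (postF cs) ++ filterᵇ S [ a ] ≡⟨ filter-++ (T? ∘ S) (postF cs) [ a ] ⟨
      filterᵇ S (postF cs ∷ʳ a)             ∎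
      where open ≡-Reasoning
    ... | false = begin
      postF (pruneF S cs)                   ≡⟨ postF-pruneF S cs ⟩
      filterᵇ S (postF cs)                  ≡⟨ ++-identityʳ _ ⟨
      filterᵇ S (postF cs) ++ []            ≡⟨ cong (filterᵇ S (postF cs) ++_) (filter-reject (T? ∘ S) (subst T e)) ⟨
      filterᵇ S (postF cs) ++ filterᵇ S [ a ] ≡⟨ filter-++ (T? ∘ S) (postF cs) [ a ] ⟨
      filterᵇ S (postF cs ∷ʳ a)             ∎
      where open ≡-Reasoning

    postF-pruneF : ∀ S (ts : Forest A) → postF (pruneF S ts) ≡ filterᵇ S (postF ts)
    postF-pruneF S []       = refl
    postF-pruneF S (t ∷ ts) = begin
      postF (pruneT S t ++ pruneF S ts)              ≡⟨ postF-++ (pruneT S t) (pruneF S ts) ⟩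
      postF (pruneT S t) ++ postF (pruneF S ts)      ≡⟨ cong₂ _++_ (postF-pruneT S t) (postF-pruneF S ts) ⟩
      filterᵇ S (postT t) ++ filterᵇ S (postF ts)    ≡⟨ filter-++ (T? ∘ S) (postT t) (postF ts) ⟨
      filterᵇ S (postT t ++ postF ts)                ∎
      where open ≡-Reasoning

  mutual
    pruneT-∧ : ∀ S₁ S₂ (t : Tree A) → pruneF S₂ (pruneT S₁ t) ≡ pruneT (λ u → S₁ u ∧ S₂ u) t
    pruneT-∧ S₁ S₂ (lnode a cs) with S₁ a
    ... | false = pruneF-∧ S₁ S₂ cs
    ... | true with S₂ a
    ...   | true  = cong (λ fs → lnode a fs ∷ []) (pruneF-∧ S₁ S₂ cs)
    ...   | false = trans (++-identityʳ _) (pruneF-∧ S₁ S₂ cs)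

    pruneF-∧ : ∀ S₁ S₂ (ts : Forest A) → pruneF S₂ (pruneF S₁ ts) ≡ pruneF (λ u → S₁ u ∧ S₂ u) ts
    pruneF-∧ S₁ S₂ []       = refl
    pruneF-∧ S₁ S₂ (t ∷ ts) =
      trans (pruneF-++ S₂ (pruneT S₁ t) (pruneF S₁ ts)) (cong₂ _++_ (pruneT-∧ S₁ S₂ t) (pruneF-∧ S₁ S₂ ts))

  mutual
    pruneT-cong : ∀ S S′ (t : Tree A) → (∀ {x} → x ∈ preT t → S x ≡ S′ x) → pruneT S t ≡ pruneT S′ t
    pruneT-cong S S′ (lnode a cs) f with S a | S′ a | f (here refl)
    ... | true  | true  | _ = cong (λ fs → lnode a fs ∷ []) (pruneF-cong S S′ cs (f ∘ there))
    ... | false | false | _ = pruneF-cong S S′ cs (f ∘ there)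

    pruneF-cong : ∀ S S′ (ts : Forest A) → (∀ {x} → x ∈ preF ts → S x ≡ S′ x) → pruneF S ts ≡ pruneF S′ ts
    pruneF-cong S S′ []       f = refl
    pruneF-cong S S′ (t ∷ ts) f =
      cong₂ _++_ (pruneT-cong S S′ t (f ∘ ∈-++⁺ˡ)) (pruneF-cong S S′ ts (f ∘ ∈-++⁺ʳ (preT t)))

  mutual
    pruneT-all : ∀ S (t : Tree A) → (∀ {x} → x ∈ preT t → T (S x)) → pruneT S t ≡ t ∷ []
    pruneT-all S (lnode a cs) f with S a | f (here refl)
    ... | true | _ = cong (λ fs → lnode a fs ∷ []) (pruneF-all S cs (f ∘ there))

    pruneF-all : ∀ S (ts : Forest A) → (∀ {x} → x ∈ preF ts → T (S x)) → pruneF S ts ≡ ts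
    pruneF-all S []       f = refl
    pruneF-all S (t ∷ ts) f = cong₂ _++_ (pruneT-all S t (f ∘ ∈-++⁺ˡ)) (pruneF-all S ts (f ∘ ∈-++⁺ʳ (preT t)))

pruneF-remove : ∀ a cs (xs ys : Forest ℕ) → a ∉ preF xs ++ preF cs ++ preF ys →
                pruneF (λ u → not (u ≡ᵇ a)) (xs ++ lnode a cs ∷ ys) ≡ xs ++ cs ++ ys
pruneF-remove a cs xs ys a∉ = begin
  pruneF ≢a (xs ++ lnode a cs ∷ ys)                ≡⟨ pruneF-++ ≢a xs (lnode a cs ∷ ys) ⟩
  pruneF ≢a xs ++ pruneT ≢a (lnode a cs) ++ pruneF ≢a ys
    ≡⟨ cong (λ b → pruneF ≢a xs ++ (if not b then lnode a (pruneF ≢a cs) ∷ [] else pruneF ≢a cs) ++ pruneF ≢a ys) (≡ᵇ-refl a) ⟩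
  pruneF ≢a xs ++ pruneF ≢a cs ++ pruneF ≢a ys
    ≡⟨ cong₂ _++_ (pruneF-all ≢a xs (keep ∘ ∈-++⁺ˡ))
                  (cong₂ _++_ (pruneF-all ≢a cs (keep ∘ ∈-++⁺ʳ (preF xs) ∘ ∈-++⁺ˡ))
                              (pruneF-all ≢a ys (keep ∘ ∈-++⁺ʳ (preF xs) ∘ ∈-++⁺ʳ (preF cs)))) ⟩
  xs ++ cs ++ ys                                    ∎
  where
  open ≡-Reasoning
  ≢a : ℕ → Bool
  ≢a u = not (u ≡ᵇ a)
  keep : ∀ {x} → x ∈ preF xs ++ preF cs ++ preF ys → T (≢a x)
  keep {x} x∈ = T-not⁺ (λ x≡ᵇa → a∉ (subst (_∈ _) (≡ᵇ⇒≡ x a x≡ᵇa) x∈))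

private
  Within : ℕ → ℕ → ℕ → Set
  Within lo hi x = lo ≤ x × x < hi

mutual
  labT-ascending : ∀ n t → let t′ , m = labT n t in n < m × All (Within n m) (preT t′) × Ascending (preT t′)
  labT-ascending n (node ts) with labF-ascending (suc n) ts
  ... | n<m , within , asc = n<m , (≤-refl , n<m) ∷ All.map (Data.Product.map₁ <⇒≤) within , All.map proj₁ within ∷ asc

  labF-ascending : ∀ n ts → let ts′ , m = labF n ts in n ≤ m × All (Within n m) (preF ts′) × Ascending (preF ts′)
  labF-ascending n []       = ≤-refl , [] , []
  labF-ascending n (t ∷ ts) with labT-ascending n t | labF-ascending (proj₂ (labT n t)) ts
  ... | n<m , within₁ , asc₁ | m≤k , within₂ , asc₂ =
    ≤-trans (<⇒≤ n<m) m≤k ,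
    Allₚ.++⁺ (All.map (Data.Product.map₂ (λ x<m → <-≤-trans x<m m≤k)) within₁)
             (All.map (Data.Product.map₁ (≤-trans (<⇒≤ n<m))) within₂) ,
    AllPairsₚ.++⁺ asc₁ asc₂ (All.map (λ (_ , x<m) → All.map (λ (m≤y , _) → <-≤-trans x<m m≤y) within₂) within₁)

label-ascending : ∀ T → Ascending (preT (label T))
label-ascending T = proj₂ (proj₂ (labT-ascending 0 T))

-- LCA T F is argmax (depth T F) 0 (filterᵇ (commonAnc T F) (preT (label T))).
argmax : (ℕ → ℕ) → ℕ → List ℕ → ℕ
argmax d z = foldr (λ u best → if d best <ᵇ d u then u else best) z

argmax-∈ : ∀ (d : ℕ → ℕ) z xs → argmax d z xs ≡ z ⊎ argmax d z xs ∈ xs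
argmax-∈ d z []       = inj₁ refl
argmax-∈ d z (y ∷ ys) with d (argmax d z ys) <ᵇ d y
... | true  = inj₂ (here refl)
... | false = Data.Sum.map₂ there (argmax-∈ d z ys)

argmax-maximal : ∀ (d : ℕ → ℕ) z xs {x} → x ∈ xs → d x ≤ d (argmax d z xs)
argmax-maximal d z (y ∷ ys) {x} x∈ with d (argmax d z ys) <ᵇ d y in e | x∈
... | true  | here refl = ≤-refl
... | true  | there x∈ys = ≤-trans (argmax-maximal d z ys x∈ys) (<⇒≤ (<ᵇ⇒< (d (argmax d z ys)) (d y) (subst T (sym e) tt)))
... | false | here refl = ≮⇒≥ (λ lt → subst T e (<⇒<ᵇ lt))
... | false | there x∈ys = argmax-maximal d z ys x∈ys

-- Pigeonhole and arithmetic

unique-lookup-injective : ∀ {A : Set} {xs : List A} → Unique xs → ∀ {i j} → lookup xs i ≡ lookup xs j → i ≡ j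
unique-lookup-injective (_  ∷ _) {zero}  {zero}  _  = refl
unique-lookup-injective (x∉ ∷ _) {zero}  {suc j} eq = contradiction eq (All.lookup x∉ (∈-lookup j))
unique-lookup-injective (x∉ ∷ _) {suc i} {zero}  eq = contradiction (sym eq) (All.lookup x∉ (∈-lookup i))
unique-lookup-injective (_  ∷ u) {suc i} {suc j} eq = cong suc (unique-lookup-injective u eq)

length≤-injection : ∀ {A : Set} {xs : List A} {m} → Unique xs → (c : ∀ {x} → x ∈ xs → Fin m) →
                    (∀ {x y} (x∈ : x ∈ xs) (y∈ : y ∈ xs) → c x∈ ≡ c y∈ → x ≡ y) → length xs ≤ m
length≤-injection {xs = xs} u c c-injective =
  injective⇒≤ (unique-lookup-injective u ∘ c-injective (∈-lookup _) (∈-lookup _))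

length≤-bounded-spread : ∀ {A : Set} {xs : List A} (f g : A → ℕ) d → Unique xs →
  (∀ {x y} → x ∈ xs → y ∈ xs → f x ≤ f y + d × g x ≤ g y + d) →
  (∀ {x y} → x ∈ xs → y ∈ xs → f x ≡ f y → g x ≡ g y → x ≡ y) →
  length xs ≤ suc (d + d) * suc (d + d)
length≤-bounded-spread {xs = []}      f g d _ _ _ = z≤n
length≤-bounded-spread {A} {x₀ ∷ xs} f g d u spread f×g-injective = length≤-injection u code code-injective
  where
  x₀∈ : x₀ ∈ x₀ ∷ xs
  x₀∈ = here refl
  -- Every f x lies within d of f x₀, so f x + d ∸ f x₀ ≤ d + d; likewise for g.
  shifted<width : ∀ (h : A → ℕ) → (∀ {x y} → x ∈ x₀ ∷ xs → y ∈ x₀ ∷ xs → h x ≤ h y + d) →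
                  ∀ {x} → x ∈ x₀ ∷ xs → h x + d ∸ h x₀ < suc (d + d)
  shifted<width h h-spread x∈ =
    s≤s (m≤n+o⇒m∸n≤o (h _ + d) (h x₀) (≤-trans (+-monoˡ-≤ d (h-spread x∈ x₀∈)) (≤-reflexive (+-assoc (h x₀) d d))))
  shifted-injective : ∀ (h : A → ℕ) → (∀ {x y} → x ∈ x₀ ∷ xs → y ∈ x₀ ∷ xs → h x ≤ h y + d) →
                      ∀ {x y} → x ∈ x₀ ∷ xs → y ∈ x₀ ∷ xs → h x + d ∸ h x₀ ≡ h y + d ∸ h x₀ → h x ≡ h y
  shifted-injective h h-spread x∈ y∈ eq =
    +-cancelʳ-≡ d _ _ (∸-cancelʳ-≡ (h-spread x₀∈ x∈) (h-spread x₀∈ y∈) eq)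
  f-spread : ∀ {x y} → x ∈ x₀ ∷ xs → y ∈ x₀ ∷ xs → f x ≤ f y + d
  f-spread x∈ y∈ = proj₁ (spread x∈ y∈)
  g-spread : ∀ {x y} → x ∈ x₀ ∷ xs → y ∈ x₀ ∷ xs → g x ≤ g y + d
  g-spread x∈ y∈ = proj₂ (spread x∈ y∈)
  code : ∀ {x} → x ∈ x₀ ∷ xs → Fin (suc (d + d) * suc (d + d))
  code x∈ = combine (fromℕ< (shifted<width f f-spread x∈)) (fromℕ< (shifted<width g g-spread x∈))
  code-injective : ∀ {x y} (x∈ : x ∈ x₀ ∷ xs) (y∈ : y ∈ x₀ ∷ xs) → code x∈ ≡ code y∈ → x ≡ y
  code-injective x∈ y∈ eq =
    let f≡ , g≡ = combine-injective _ _ _ _ eq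
    in f×g-injective x∈ y∈
         (shifted-injective f f-spread x∈ y∈ (fromℕ<-injective _ _ _ _ f≡))
         (shifted-injective g g-spread x∈ y∈ (fromℕ<-injective _ _ _ _ g≡))

m≤n+∣m⊖n∣ : ∀ m n → m ≤ n + ∣ m ⊖ n ∣
m≤n+∣m⊖n∣ m n with ≤-total m n
... | inj₁ m≤n = ≤-trans m≤n (m≤m+n n _)
... | inj₂ n≤m = ≤-reflexive (sym (begin
  n + ∣ m ⊖ n ∣ ≡⟨ cong (_+_ n) (trans (ℤ.∣m⊖n∣≡∣n⊖m∣ m n) (ℤ.∣⊖∣-≤ n≤m)) ⟩
  n + (m ∸ n)   ≡⟨ m+[n∸m]≡n n≤m ⟩
  m             ∎))
  where open ≡-Reasoning

near-common⇒≤ : ∀ x y (a : ℤ) k → ∣ + x - a ∣ ≤ k → ∣ + y - a ∣ ≤ k → y ≤ x + (k + k)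
near-common⇒≤ x y a k x-near y-near =
  ≤-trans (m≤n+∣m⊖n∣ y x) (+-monoʳ-≤ x (≤-trans triangle (+-mono-≤ y-near x-near)))
  where
  open ℤ-Solver
  y-x≡ : (+ y - a) - (+ x - a) ≡ y ⊖ x
  y-x≡ = trans (solve 3 (λ i j c → (i :- c) :- (j :- c) := i :- j) refl (+ y) (+ x) a) (ℤ.m-n≡m⊖n y x)
  triangle : ∣ y ⊖ x ∣ ≤ ∣ + y - a ∣ + ∣ + x - a ∣
  triangle = subst (_≤ ∣ + y - a ∣ + ∣ + x - a ∣) (cong ∣_∣ y-x≡) (ℤ.∣i-j∣≤∣i∣+∣j∣ (+ y - a) (+ x - a))

≤-from-equal-sums : ∀ {x x′ y y′ z z′} d → x + y + z ≡ x′ + y′ + z′ → y′ ≤ y + d → z′ ≤ z + d → x ≤ x′ + (d + d)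
≤-from-equal-sums {x} {x′} {y} {y′} {z} {z′} d eq y′≤ z′≤ = +-cancelʳ-≤ (y + z) x (x′ + (d + d)) (begin
  x + (y + z)                ≡⟨ +-assoc x y z ⟨
  x + y + z                  ≡⟨ eq ⟩
  x′ + y′ + z′               ≤⟨ +-mono-≤ (+-monoʳ-≤ x′ y′≤) z′≤ ⟩
  x′ + (y + d) + (z + d)     ≡⟨ solve 4 (λ a b c e → a :+ (b :+ e) :+ (c :+ e) := a :+ (e :+ e) :+ (b :+ c)) refl x′ y z d ⟩
  x′ + (d + d) + (y + z)     ∎)
  where
  open ≤-Reasoning
  open +-*-Solver

width-bound : ∀ k → 1 ≤ k → let d = k + k + (k + k) in suc (d + d) * suc (d + d) ≤ 81 * (k * k)
width-bound k 1≤k = begin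
  suc (8k) * suc (8k)   ≤⟨ *-mono-≤ 1+8k≤9k 1+8k≤9k ⟩
  (k + 8 * k) * (k + 8 * k) ≡⟨ solve 1 (λ k → (k :+ con 8 :* k) :* (k :+ con 8 :* k) := con 81 :* (k :* k)) refl k ⟩
  81 * (k * k)          ∎
  where
  open ≤-Reasoning
  open +-*-Solver
  8k : ℕ
  8k = k + k + (k + k) + (k + k + (k + k))
  1+8k≤9k : suc 8k ≤ k + 8 * k
  1+8k≤9k = +-mono-≤ 1≤k (≤-reflexive (solve 1 (λ k → k :+ k :+ (k :+ k) :+ (k :+ k :+ (k :+ k)) := con 8 :* k) refl k))

-- Subforests of T

module Nodes (T₀ : OTree) where

  LT : Tree ℕ
  LT = label T₀

  X : Forest ℕ
  X = LT ∷ []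

  N P : List ℕ
  N = preT LT
  P = postT LT

  -- postIndex and ancestor below are post T₀ F and anc T₀ F, which do not depend on F.
  postIndex : ℕ → ℕ
  postIndex u = indexOf u P

  N-ascending : Ascending N
  N-ascending = label-ascending T₀

  P-unique : Unique P
  P-unique = unique-postT LT (AllPairs.map <⇒≢ N-ascending)

  postIndex-increasing : AllPairs (λ x y → postIndex x < postIndex y) P
  postIndex-increasing = indexOf-increasing P P-unique

  N⊆P : N ⊆ P
  N⊆P = preT⊆postT LT

  preF-X : preF X ≡ N
  preF-X = ++-identityʳ N

  postF-X : postF X ≡ P
  postF-X = ++-identityʳ P

  ancestor : ℕ → ℕ → Bool
  ancestor u v = elem v (subT u LT)

  ancestor⇒ordered : ∀ {u v} → T (ancestor u v) → u ∈ N × v ∈ N × u ≤ v × postIndex v ≤ postIndex u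
  ancestor⇒ordered {u} {v} h =
    let v∈ = elem⇒∈ (subT u LT) h
        u∈N , v∈N = subT⊆preT LT v∈
    in u∈N , v∈N , ∈-subT⇒ordered LT N-ascending v∈

  ordered⇒ancestor : ∀ {u v} → u ∈ N → v ∈ N → u ≤ v → postIndex v ≤ postIndex u → T (ancestor u v)
  ordered⇒ancestor u∈ v∈ u≤v post≤ = ∈⇒elem (ordered⇒∈-subT LT N-ascending u∈ v∈ u≤v post≤)

  ancestor-refl : ∀ {u} → u ∈ N → T (ancestor u u)
  ancestor-refl u∈ = ordered⇒ancestor u∈ u∈ ≤-refl ≤-refl

  ancestor-trans : ∀ {u v w} → T (ancestor u v) → T (ancestor v w) → T (ancestor u w)
  ancestor-trans {u} {v} {w} h₁ h₂ =
    let u∈ , _ , u≤v , post≤₁ = ancestor⇒ordered {u} {v} h₁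
        _ , w∈ , v≤w , post≤₂ = ancestor⇒ordered {v} {w} h₂
    in ordered⇒ancestor u∈ w∈ (≤-trans u≤v v≤w) (≤-trans post≤₂ post≤₁)

  ancestor-antisym : ∀ {u v} → T (ancestor u v) → T (ancestor v u) → u ≡ v
  ancestor-antisym {u} {v} h₁ h₂ =
    ≤-antisym (proj₁ (proj₂ (proj₂ (ancestor⇒ordered {u} {v} h₁))))
              (proj₁ (proj₂ (proj₂ (ancestor⇒ordered {v} {u} h₂))))

  ancestor-nested : ∀ {u v w} → T (ancestor w v) → T (ancestor u v) → T (ancestor w u) ⊎ T (ancestor u w)
  ancestor-nested {u} {v} {w} h₁ h₂ =
    Data.Sum.map (∈⇒elem {u} {subT w LT}) (∈⇒elem {w} {subT u LT}) (subT-nested LT N-ascending (elem⇒∈ {v} (subT w LT) h₁) (elem⇒∈ {v} (subT u LT) h₂))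

  root∈N : 0 ∈ N
  root∈N = root-first T₀
    where
    root-first : ∀ T → 0 ∈ preT (label T)
    root-first (node _) = here refl

  root-ancestor : ∀ {v} → v ∈ N → T (ancestor 0 v)
  root-ancestor {v} v∈ = ∈⇒elem (subst (v ∈_) (sym (root-subtree T₀)) v∈)
    where
    root-subtree : ∀ T → subT 0 (label T) ≡ preT (label T)
    root-subtree (node _) = refl

  ancestor-strict : ∀ {u v} → T (ancestor u v) → u ≢ v → u < v × postIndex v < postIndex u
  ancestor-strict {u} {v} h u≢v =
    let u∈ , v∈ , u≤v , post≤ = ancestor⇒ordered {u} {v} h
    in ≤∧≢⇒< u≤v u≢v , ≤∧≢⇒< post≤ (u≢v ∘ indexOf-injective P (N⊆P u∈) (N⊆P v∈) ∘ sym)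

  depth-mono-< : ∀ {u v} → T (ancestor u v) → u ≢ v → v ∈ N →
                 count (λ w → ancestor w u) N < count (λ w → ancestor w v) N
  depth-mono-< {u} {v} h u≢v v∈ =
    count-mono-< (λ w → ancestor w u) (λ w → ancestor w v) N (λ {w} _ hw → ancestor-trans {w} {u} {v} hw h)
      v∈ (ancestor-refl v∈) (λ h′ → u≢v (ancestor-antisym {u} {v} h h′))

  window : ℕ → ℕ → ℕ → Bool
  window p q u = (p ≤ᵇ u) ∧ (postIndex u <ᵇ q)

  window⁻ : ∀ p q {u} → T (window p q u) → p ≤ u × postIndex u < q
  window⁻ p q {u} h =
    let p≤u , post< = Equivalence.to (T-∧ {p ≤ᵇ u}) h in ≤ᵇ⇒≤ p u p≤u , <ᵇ⇒< (postIndex u) q post<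

  window⁺ : ∀ p q {u} → p ≤ u → postIndex u < q → T (window p q u)
  window⁺ p q {u} p≤u post< = Equivalence.from (T-∧ {p ≤ᵇ u}) (≤⇒≤ᵇ p≤u , <⇒<ᵇ post<)

  IsWindow : Forest ℕ → Set
  IsWindow F = Σ ℕ λ p → Σ ℕ λ q → F ≡ pruneF (window p q) X

  preF-pruneX : ∀ S → preF (pruneF S X) ≡ filterᵇ S N
  preF-pruneX S = trans (preF-pruneF S X) (cong (filterᵇ S) preF-X)

  postF-pruneX : ∀ S → postF (pruneF S X) ≡ filterᵇ S P
  postF-pruneX S = trans (postF-pruneF S X) (cong (filterᵇ S) postF-X)

  pruneX-cong : ∀ S S′ → (∀ {x} → x ∈ N → S x ≡ S′ x) → pruneF S X ≡ pruneF S′ X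
  pruneX-cong S S′ f = pruneF-cong S S′ X (f ∘ subst (_ ∈_) preF-X)

  pruneX-remove : ∀ {F F′} S S′ a → F ≡ pruneF S X → F′ ≡ pruneF (λ u → not (u ≡ᵇ a)) F →
                  (∀ {x} → x ∈ N → (S x ∧ not (x ≡ᵇ a)) ≡ S′ x) → F′ ≡ pruneF S′ X
  pruneX-remove {F} {F′} S S′ a F≡ F′≡ pointwise = begin
    F′                              ≡⟨ F′≡ ⟩
    pruneF ≢a F                     ≡⟨ cong (pruneF ≢a) F≡ ⟩
    pruneF ≢a (pruneF S X)          ≡⟨ pruneF-∧ S ≢a X ⟩
    pruneF (λ u → S u ∧ ≢a u) X     ≡⟨ pruneX-cong _ S′ pointwise ⟩
    pruneF S′ X                     ∎
    where
    open ≡-Reasoning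
    ≢a : ℕ → Bool
    ≢a u = not (u ≡ᵇ a)

  -- The removed root is the first node of the window in preorder.
  window-dropL : ∀ {a cs ts} → IsWindow (lnode a cs ∷ ts) → IsWindow (cs ++ ts)
  window-dropL {a} {cs} {ts} (p , q , F≡) =
    suc a , q , pruneX-remove S (window (suc a) q) a F≡ (sym (pruneF-remove a cs [] ts a∉)) pointwise
    where
    S = window p q
    nodes≡ : a ∷ preF cs ++ preF ts ≡ filterᵇ S N
    nodes≡ = trans (cong preF F≡) (preF-pruneX S)
    a<rest : All (a <_) (preF cs ++ preF ts)
    a<rest = AllPairs.head (subst Ascending (sym nodes≡) (AllPairsₚ.filter⁺ (T? ∘ S) N-ascending))
    a∉ : a ∉ preF cs ++ preF ts
    a∉ a∈ = <-irrefl refl (All.lookup a<rest a∈)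
    a-in : T (S a)
    a-in = proj₂ (∈-filter⁻ (T? ∘ S) {xs = N} (subst (a ∈_) nodes≡ (here refl)))
    pointwise : ∀ {x} → x ∈ N → (S x ∧ not (x ≡ᵇ a)) ≡ window (suc a) q x
    pointwise {x} x∈ = T-ext fw bw
      where
      fw : T (S x ∧ not (x ≡ᵇ a)) → T (window (suc a) q x)
      fw h with Sx , x≢a ← Equivalence.to (T-∧ {S x}) h
           with subst (x ∈_) (sym nodes≡) (∈-filter⁺ (T? ∘ S) x∈ Sx)
      ... | here x≡a     = contradiction (≡⇒≡ᵇ x a x≡a) (T-not⁻ x≢a)
      ... | there x∈rest = window⁺ (suc a) q (All.lookup a<rest x∈rest) (proj₂ (window⁻ p q Sx))
      bw : T (window (suc a) q x) → T (S x ∧ not (x ≡ᵇ a))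
      bw h = let a<x , post< = window⁻ (suc a) q h in Equivalence.from (T-∧ {S x})
        ( window⁺ p q (≤-trans (proj₁ (window⁻ p q a-in)) (<⇒≤ a<x)) post<
        , T-not⁺ (λ x≡ᵇa → <-irrefl (sym (≡ᵇ⇒≡ x a x≡ᵇa)) a<x))

  -- The removed root is the last node of the window in postorder.
  window-dropR : ∀ {b cs ts} → IsWindow (ts ∷ʳ lnode b cs) → IsWindow (ts ++ cs)
  window-dropR {b} {cs} {ts} (p , q , F≡) =
    p , postIndex b , pruneX-remove S (window p (postIndex b)) b F≡ removed pointwise
    where
    S = window p q
    order≡ : (postF ts ++ postF cs) ++ [ b ] ≡ filterᵇ S P
    order≡ = begin
      (postF ts ++ postF cs) ++ [ b ]       ≡⟨ ++-assoc (postF ts) (postF cs) [ b ] ⟩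
      postF ts ++ postF cs ∷ʳ b             ≡⟨ cong (postF ts ++_) (++-identityʳ _) ⟨
      postF ts ++ postF (lnode b cs ∷ [])   ≡⟨ postF-++ ts (lnode b cs ∷ []) ⟨
      postF (ts ∷ʳ lnode b cs)              ≡⟨ cong postF F≡ ⟩
      postF (pruneF S X)                    ≡⟨ postF-pruneX S ⟩
      filterᵇ S P                           ∎
      where open ≡-Reasoning
    before-b : ∀ {R : ℕ → ℕ → Set} → AllPairs R P → ∀ {x} → x ∈ postF ts ++ postF cs → R x b
    before-b {R} ordered x∈ =
      AllPairs-++⁻-across (postF ts ++ postF cs) (subst (AllPairs R) (sym order≡) (AllPairsₚ.filter⁺ (T? ∘ S) ordered))
        x∈ (here refl)
    pre⊆post : preF ts ++ preF cs ++ [] ⊆ postF ts ++ postF cs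
    pre⊆post x∈ with ∈-++⁻ (preF ts) x∈
    ... | inj₁ x∈ts = ∈-++⁺ˡ (preF⊆postF ts x∈ts)
    ... | inj₂ x∈cs = ∈-++⁺ʳ (postF ts) (preF⊆postF cs (subst (_ ∈_) (++-identityʳ (preF cs)) x∈cs))
    removed : ts ++ cs ≡ pruneF (λ u → not (u ≡ᵇ b)) (ts ∷ʳ lnode b cs)
    removed = trans (cong (ts ++_) (sym (++-identityʳ cs)))
                    (sym (pruneF-remove b cs ts [] (λ b∈ → before-b P-unique (pre⊆post b∈) refl)))
    b-in : T (S b)
    b-in = proj₂ (∈-filter⁻ (T? ∘ S) {xs = P} (subst (b ∈_) order≡ (∈-++⁺ʳ _ (here refl))))
    pointwise : ∀ {x} → x ∈ N → (S x ∧ not (x ≡ᵇ b)) ≡ window p (postIndex b) x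
    pointwise {x} x∈ = T-ext fw bw
      where
      fw : T (S x ∧ not (x ≡ᵇ b)) → T (window p (postIndex b) x)
      fw h with Sx , x≢b ← Equivalence.to (T-∧ {S x}) h
           with ∈-++⁻ (postF ts ++ postF cs) (subst (x ∈_) (sym order≡) (∈-filter⁺ (T? ∘ S) (N⊆P x∈) Sx))
      ... | inj₁ x∈front    = window⁺ p (postIndex b) (proj₁ (window⁻ p q Sx)) (before-b postIndex-increasing x∈front)
      ... | inj₂ (here x≡b) = contradiction (≡⇒≡ᵇ x b x≡b) (T-not⁻ x≢b)
      bw : T (window p (postIndex b) x) → T (S x ∧ not (x ≡ᵇ b))
      bw h = let p≤x , x<b = window⁻ p (postIndex b) h in Equivalence.from (T-∧ {S x})
        ( window⁺ p q p≤x (<-trans x<b (proj₂ (window⁻ p q b-in)))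
        , T-not⁺ (λ x≡ᵇb → <-irrefl (cong postIndex (≡ᵇ⇒≡ x b x≡ᵇb)) x<b))

  subforest⇒window : ∀ {F} → SubforestOf X F → IsWindow F
  subforest⇒window here      = 0 , length P , sym (pruneF-all _ X λ x∈ →
    window⁺ 0 (length P) z≤n (indexOf<length P (N⊆P (subst (_ ∈_) preF-X x∈))))
  subforest⇒window (dropL s) = window-dropL (subforest⇒window s)
  subforest⇒window (dropR s) = window-dropR (subforest⇒window s)

  -- By inMU≡ below, precedes F = LU_F ∪ MU_F and follows F = RU_F ∪ MU_F.
  precedes follows : Forest ℕ → ℕ → Bool
  precedes F u = all (λ v → u <ᵇ v) (preF F)
  follows  F u = all (λ v → postIndex v <ᵇ postIndex u) (preF F)

  precedes⇒< : ∀ F {u v} → T (precedes F u) → v ∈ preF F → u < v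
  precedes⇒< F {u} {v} h v∈ = <ᵇ⇒< u v (all-lookup (λ v → u <ᵇ v) h v∈)

  <⇒precedes : ∀ F {u} → (∀ {v} → v ∈ preF F → u < v) → T (precedes F u)
  <⇒precedes F {u} f = all-tabulate (λ v → u <ᵇ v) (<⇒<ᵇ ∘ f)

  follows⇒< : ∀ F {u v} → T (follows F u) → v ∈ preF F → postIndex v < postIndex u
  follows⇒< F {u} {v} h v∈ = <ᵇ⇒< (postIndex v) (postIndex u) (all-lookup (λ v → postIndex v <ᵇ postIndex u) h v∈)

  <⇒follows : ∀ F {u} → (∀ {v} → v ∈ preF F → postIndex v < postIndex u) → T (follows F u)
  <⇒follows F {u} f = all-tabulate (λ v → postIndex v <ᵇ postIndex u) (<⇒<ᵇ ∘ f)

  precedes-downClosed : ∀ F → DownClosed _<_ (precedes F)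
  precedes-downClosed F x<y h = <⇒precedes F (<-trans x<y ∘ precedes⇒< F h)

  follows-upClosed : ∀ F → UpClosed (λ x y → postIndex x < postIndex y) (follows F)
  follows-upClosed F x<y h = <⇒follows F (λ v∈ → <-trans (follows⇒< F h v∈) x<y)

  module NonemptyWindow {F p q} (F≡ : F ≡ pruneF (window p q) X) (F≢[] : F ≢ []) where

    S : ℕ → Bool
    S = window p q

    nodes≡ : preF F ≡ filterᵇ S N
    nodes≡ = trans (cong preF F≡) (preF-pruneX S)

    F⊆N : preF F ⊆ N
    F⊆N x∈ = proj₁ (∈-filter⁻ (T? ∘ S) {xs = N} (subst (_ ∈_) nodes≡ x∈))

    F⊆window : ∀ {x} → x ∈ preF F → T (S x)
    F⊆window x∈ = proj₂ (∈-filter⁻ (T? ∘ S) {xs = N} (subst (_ ∈_) nodes≡ x∈))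

    window⊆F : ∀ {x} → x ∈ N → T (S x) → x ∈ preF F
    window⊆F x∈ Sx = subst (_ ∈_) (sym nodes≡) (∈-filter⁺ (T? ∘ S) x∈ Sx)

    some-node : Σ ℕ (_∈ preF F)
    some-node = nonempty-has-node F F≢[]

    window≡neither : ∀ {u} → u ∈ N → S u ≡ not (precedes F u ∨ follows F u)
    window≡neither {u} u∈ = T-ext fw bw
      where
      fw : T (S u) → T (not (precedes F u ∨ follows F u))
      fw Su = T-not⁺ λ h → Data.Sum.[ (λ pr → <-irrefl refl (precedes⇒< F pr (window⊆F u∈ Su)))
                                     , (λ fo → <-irrefl refl (follows⇒< F fo (window⊆F u∈ Su))) ]
                                     (Equivalence.to (T-∨ {precedes F u}) h)
      bw : T (not (precedes F u ∨ follows F u)) → T (S u)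
      bw h with p ≤? u
      ... | no u<p = contradiction (Equivalence.from (T-∨ {precedes F u}) (inj₁
              (<⇒precedes F (λ v∈ → <-≤-trans (≰⇒> u<p) (proj₁ (window⁻ p q (F⊆window v∈)))))))
              (T-not⁻ h)
      ... | yes p≤u with postIndex u <? q
      ...   | yes u<q = window⁺ p q p≤u u<q
      ...   | no q≤u  = contradiction (Equivalence.from (T-∨ {precedes F u}) (inj₂
              (<⇒follows F (λ v∈ → <-≤-trans (proj₂ (window⁻ p q (F⊆window v∈))) (≮⇒≥ q≤u)))))
              (T-not⁻ h)

    private
      v₀ : ℕ
      v₀ = proj₁ some-node

      v₀∈F : v₀ ∈ preF F
      v₀∈F = proj₂ some-node

    common : ℕ → Bool
    common = commonAnc T₀ F

    common⇒ancestor : ∀ {u v} → T (common u) → v ∈ preF F → T (ancestor u v)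
    common⇒ancestor {u} = all-lookup (ancestor u)

    LCA-common : LCA T₀ F ∈ N × T (common (LCA T₀ F))
    LCA-common with argmax-∈ (depth T₀ F) 0 (filterᵇ common N)
    ... | inj₂ L∈ = ∈-filter⁻ (T? ∘ common) {xs = N} L∈
    ... | inj₁ L≡0 rewrite L≡0 =
      root∈N , all-tabulate (ancestor 0) (root-ancestor ∘ F⊆N)

    LCA-lowest : ∀ {w} → w ∈ N → T (common w) → T (ancestor w (LCA T₀ F))
    LCA-lowest {w} w∈ cw with ancestor-nested {LCA T₀ F} {v₀} {w} (common⇒ancestor cw v₀∈F)
                                              (common⇒ancestor (proj₂ LCA-common) v₀∈F)
    ... | inj₁ w≼L = w≼L
    ... | inj₂ L≼w with w ≟ LCA T₀ F
    ...   | yes w≡L = subst (T ∘ ancestor w) w≡L (ancestor-refl w∈)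
    ...   | no w≢L  = contradiction
      (argmax-maximal (depth T₀ F) 0 (filterᵇ common N) (∈-filter⁺ (T? ∘ common) w∈ cw))
      (<⇒≱ (depth-mono-< {LCA T₀ F} {w} L≼w (w≢L ∘ sym) w∈))

    inMU≡ : ∀ {u} → u ∈ N → inMU T₀ F u ≡ precedes F u ∧ follows F u
    inMU≡ {u} u∈ = T-ext fw bw
      where
      L = LCA T₀ F
      fw : T (inMU T₀ F u) → T (precedes F u ∧ follows F u)
      fw h = Equivalence.from (T-∧ {precedes F u}) (<⇒precedes F (proj₁ ∘ below) , <⇒follows F (proj₂ ∘ below))
        where
        u≼L : T (ancestor u L)
        u≼L = proj₁ (Equivalence.to (T-∧ {ancestor u L}) h)
        L-excluded : T (not (u ≡ᵇ L) ∨ not (elem L (preF F)))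
        L-excluded = proj₂ (Equivalence.to (T-∧ {ancestor u L}) h)
        u∉F : u ∉ preF F
        u∉F u∈F with refl ← ancestor-antisym {u} {L} u≼L (common⇒ancestor (proj₂ LCA-common) u∈F) =
          Data.Sum.[ (λ h′ → T-not⁻ h′ (≡⇒≡ᵇ u u refl)) , (λ h′ → T-not⁻ h′ (∈⇒elem u∈F)) ]
            (Equivalence.to (T-∨ {not (u ≡ᵇ u)}) L-excluded)
        below : ∀ {v} → v ∈ preF F → u < v × postIndex v < postIndex u
        below {v} v∈ = ancestor-strict {u} {v} (ancestor-trans {u} {L} {v} u≼L (common⇒ancestor (proj₂ LCA-common) v∈))
                                       (λ { refl → u∉F v∈ })
      bw : T (precedes F u ∧ follows F u) → T (inMU T₀ F u)
      bw h = Equivalence.from (T-∧ {ancestor u L}) (u≼L , L-excluded)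
        where
        pr : T (precedes F u)
        pr = proj₁ (Equivalence.to (T-∧ {precedes F u}) h)
        fo : T (follows F u)
        fo = proj₂ (Equivalence.to (T-∧ {precedes F u}) h)
        u≼L : T (ancestor u L)
        u≼L = LCA-lowest u∈ (all-tabulate (ancestor u) λ v∈ →
          ordered⇒ancestor u∈ (F⊆N v∈) (<⇒≤ (precedes⇒< F pr v∈)) (<⇒≤ (follows⇒< F fo v∈)))
        L-excluded : T (not (u ≡ᵇ L) ∨ not (elem L (preF F)))
        L-excluded with u ≟ L
        ... | no u≢L  = Equivalence.from (T-∨ {not (u ≡ᵇ L)}) (inj₁ (T-not⁺ (u≢L ∘ ≡ᵇ⇒≡ u L)))
        ... | yes refl = Equivalence.from (T-∨ {not (u ≡ᵇ u)}) (inj₂ (T-not⁺ λ e →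
          <-irrefl refl (precedes⇒< F pr (elem⇒∈ (preF F) e))))

    size-precedes : count (precedes F) N + sizeRU T₀ F + sizeF T₀ F ≡ length N
    size-precedes = begin
      count (precedes F) N + sizeRU T₀ F + sizeF T₀ F
        ≡⟨ cong₂ (λ r f → count (precedes F) N + r + f) (count-cong _ _ N RU-pointwise) (cong length nodes≡) ⟩
      count (precedes F) N + count (λ u → not (precedes F u) ∧ follows F u) N + count S N
        ≡⟨ cong (_+_ (count (precedes F) N + count (λ u → not (precedes F u) ∧ follows F u) N)) (count-cong _ _ N window≡neither) ⟩
      count (precedes F) N + count (λ u → not (precedes F u) ∧ follows F u) N
        + count (λ u → not (precedes F u ∨ follows F u)) N
        ≡⟨ count-partition (precedes F) (follows F) N ⟩
      length N ∎
      where
      open ≡-Reasoning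
      RU-pointwise : ∀ {u} → u ∈ N → (not (inMU T₀ F u) ∧ follows F u) ≡ (not (precedes F u) ∧ follows F u)
      RU-pointwise {u} u∈ rewrite inMU≡ u∈ with precedes F u | follows F u
      ... | true  | true  = refl
      ... | true  | false = refl
      ... | false | _     = refl

    size-follows : count (follows F) N + sizeLU T₀ F + sizeF T₀ F ≡ length N
    size-follows = begin
      count (follows F) N + sizeLU T₀ F + sizeF T₀ F
        ≡⟨ cong₂ (λ l f → count (follows F) N + l + f) (count-cong _ _ N LU-pointwise) (cong length nodes≡) ⟩
      count (follows F) N + count (λ u → not (follows F u) ∧ precedes F u) N + count S N
        ≡⟨ cong (_+_ (count (follows F) N + count (λ u → not (follows F u) ∧ precedes F u) N)) (count-cong _ _ N F-pointwise) ⟩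
      count (follows F) N + count (λ u → not (follows F u) ∧ precedes F u) N
        + count (λ u → not (follows F u ∨ precedes F u)) N
        ≡⟨ count-partition (follows F) (precedes F) N ⟩
      length N ∎
      where
      open ≡-Reasoning
      LU-pointwise : ∀ {u} → u ∈ N → (not (inMU T₀ F u) ∧ precedes F u) ≡ (not (follows F u) ∧ precedes F u)
      LU-pointwise {u} u∈ rewrite inMU≡ u∈ with precedes F u | follows F u
      ... | true  | true  = refl
      ... | false | true  = refl
      ... | true  | false = refl
      ... | false | false = refl
      F-pointwise : ∀ {u} → u ∈ N → S u ≡ not (follows F u ∨ precedes F u)
      F-pointwise {u} u∈ = trans (window≡neither u∈) (cong not (∨-comm (precedes F u) (follows F u)))

  windows-determined : ∀ {F G} → IsWindow F → IsWindow G → F ≢ [] → G ≢ [] →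
                       count (precedes F) N ≡ count (precedes G) N → count (follows F) N ≡ count (follows G) N → F ≡ G
  windows-determined {F} {G} (p , q , F≡) (p′ , q′ , G≡) F≢[] G≢[] eq-pre eq-fol = begin
    F                         ≡⟨ F≡ ⟩
    pruneF (window p q) X     ≡⟨ pruneX-cong _ _ same-window ⟩
    pruneF (window p′ q′) X   ≡⟨ G≡ ⟨
    G                         ∎
    where
    open ≡-Reasoning
    module WF = NonemptyWindow {F} {p} {q} F≡ F≢[]
    module WG = NonemptyWindow {G} {p′} {q′} G≡ G≢[]
    same-precedes : ∀ {x} → x ∈ N → precedes F x ≡ precedes G x
    same-precedes = downClosed-count-unique (precedes F) (precedes G) N-ascending
                      (precedes-downClosed F) (precedes-downClosed G) eq-pre
    same-follows : ∀ {x} → x ∈ P → follows F x ≡ follows G x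
    same-follows = upClosed-count-unique (follows F) (follows G) postIndex-increasing
                     (follows-upClosed F) (follows-upClosed G)
                     (trans (count-postT (follows F) LT) (trans eq-fol (sym (count-postT (follows G) LT))))
    same-window : ∀ {x} → x ∈ N → window p q x ≡ window p′ q′ x
    same-window {x} x∈ = begin
      window p q x                         ≡⟨ WF.window≡neither x∈ ⟩
      not (precedes F x ∨ follows F x)     ≡⟨ cong₂ (λ l r → not (l ∨ r)) (same-precedes x∈) (same-follows (N⊆P x∈)) ⟩
      not (precedes G x ∨ follows G x)     ≡⟨ WG.window≡neither x∈ ⟨
      window p′ q′ x                       ∎

module Counting (T₀ : OTree) (a b c : ℤ) (k : ℕ) where
  open Nodes T₀

  Good : Forest ℕ → Set
  Good F = SubforestOf X F × F ≢ []
         × ∣ + sizeLU T₀ F - a ∣ ≤ k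
         × ∣ + sizeRU T₀ F - b ∣ ≤ k
         × ∣ + sizeF T₀ F - c ∣ ≤ k

  count-precedes count-follows : Forest ℕ → ℕ
  count-precedes F = count (precedes F) N
  count-follows  F = count (follows F) N

  module _ {F} (good : Good F) where
    private
      F-window : IsWindow F
      F-window = subforest⇒window (proj₁ good)
      module W = NonemptyWindow {F} {proj₁ F-window} {proj₁ (proj₂ F-window)} (proj₂ (proj₂ F-window)) (proj₁ (proj₂ good))

    precedes-identity : count-precedes F + sizeRU T₀ F + sizeF T₀ F ≡ length N
    precedes-identity = W.size-precedes

    follows-identity : count-follows F + sizeLU T₀ F + sizeF T₀ F ≡ length N
    follows-identity = W.size-follows

  good-spread : ∀ {F G} → Good F → Good G →
                count-precedes F ≤ count-precedes G + (k + k + (k + k)) × count-follows F ≤ count-follows G + (k + k + (k + k))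
  good-spread {F} {G} gF@(_ , _ , LU-F , RU-F , size-F) gG@(_ , _ , LU-G , RU-G , size-G) =
    ≤-from-equal-sums (k + k) (trans (precedes-identity gF) (sym (precedes-identity gG)))
      (near-common⇒≤ (sizeRU T₀ F) (sizeRU T₀ G) b k RU-F RU-G)
      (near-common⇒≤ (sizeF T₀ F) (sizeF T₀ G) c k size-F size-G) ,
    ≤-from-equal-sums (k + k) (trans (follows-identity gF) (sym (follows-identity gG)))
      (near-common⇒≤ (sizeLU T₀ F) (sizeLU T₀ G) a k LU-F LU-G)
      (near-common⇒≤ (sizeF T₀ F) (sizeF T₀ G) c k size-F size-G)

  good-determined : ∀ {F G} → Good F → Good G →
                    count-precedes F ≡ count-precedes G → count-follows F ≡ count-follows G → F ≡ G
  good-determined (sF , F≢[] , _) (sG , G≢[] , _) =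
    windows-determined (subforest⇒window sF) (subforest⇒window sG) F≢[] G≢[]

lemma13 : Σ ℕ λ C → (T : OTree) (a b c : ℤ) (k : ℕ) → 1 ≤ k →
    (Fs : List (Forest ℕ)) → Unique Fs →
    All (λ F → SubforestOf (label T ∷ []) F × F ≢ []
               × ∣ + sizeLU T F - a ∣ ≤ k
               × ∣ + sizeRU T F - b ∣ ≤ k
               × ∣ + sizeF T F - c ∣ ≤ k) Fs →
    length Fs ≤ C * (k * k)
lemma13 = 81 , λ T a b c k 1≤k Fs unique good → let open Counting T a b c k in
  ≤-trans (length≤-bounded-spread count-precedes count-follows (k + k + (k + k)) unique
             (λ F∈ G∈ → good-spread (All.lookup good F∈) (All.lookup good G∈))
             (λ F∈ G∈ → good-determined (All.lookup good F∈) (All.lookup good G∈)))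
          (width-bound k 1≤k)
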